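{- Let $\mathcal{A} = (\Sigma, E, PRE)$ be an event model with preconditions in $\mathcal{L}_{\exists, U}$, let $\alpha\in\Sigma$, and let $\varphi \in \mathcal{L}_{\exists, U}$. If $\varphi$ and all the preconditions $Pre_\beta$ ($\beta\in\Sigma$) are bisimulation-invariant, then $\langle \alpha \rangle \varphi$ is bisimulation-invariant.
   Context: A (relational) model is $\mathcal{M} = (\Omega, R, V)$ with $\Omega$ non-empty, $R \subseteq \Omega\times\Omega$, $V(p)\subseteq\Omega$ for each proposition letter $p$. The language $\mathcal{L}_{\exists, U}$ is $\varphi ::= p \mid \neg\varphi \mid \varphi \land \varphi \mid \square \varphi \mid \exists p.\varphi \mid U\varphi$, with usual Boolean clauses, $\square$ the box over $R$, $\mathcal{M},\omega \vDash \exists p.\varphi$ iff some $X\subseteq\Omega$ satisfies $\mathcal{M}[p\mapsto X],\omega\vDash\varphi$ (where $\mathcal{M}[p\mapsto X]$ revalues $p$ as $X$), and $U$ the global box (true iff the argument holds at every point). An event model is $\mathcal{A} = (\Sigma, E, PRE)$ with $\Sigma$ finite non-empty, $E \subseteq \Sigma\times\Sigma$, $PRE$ assigning a precondition formula $Pre_\beta$ to each $\beta\in\Sigma$. The product update $\mathcal{M}\otimes\mathcal{A}$ has domain $\{(\omega,\beta) \mid \mathcal{M},\omega\vDash Pre_\beta\}$, $(\omega,\beta)$ related to $(\omega',\beta')$ iff $\omega R\omega'$ and $\beta E \beta'$, and $p$ true at $(\omega,\beta)$ iff $\omega \in V(p)$; $\mathcal{M},\omega\vDash\langle\alpha\rangle\varphi$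 iff $\mathcal{M},\omega\vDash Pre_\alpha$ and $\mathcal{M}\otimes\mathcal{A},(\omega,\alpha)\vDash\varphi$. A formula $\theta$ is bisimulation-invariant if for all pointed models $(\mathcal{M},\omega)$, $(\mathcal{M}',\omega')$ that are bisimilar (in the standard modal sense, with respect to $R$ and all proposition letters), $\mathcal{M},\omega\vDash\theta$ iff $\mathcal{M}',\omega'\vDash\theta$. -}

module Defs where

open import Level using (Level; _⊔_; Lift; Setω) renaming (suc to lsuc; zero to lzero)
open import Data.Nat using (ℕ; suc; _≟_)
open import Data.Fin using (Fin)
open import Data.Product using (Σ; _×_; _,_; proj₁; proj₂)
open import Relation.Nullary using (¬_; yes; no)
open import Relation.Binary.PropositionalEquality using (_≡_)
open import Function.Bundles using (_⇔_)

-- Non-emptiness of Ω is recorded by a designated inhabitant.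
record Model (ℓ : Level) : Set (lsuc ℓ) where
  field
    Ω   : Set ℓ
    inh : Ω
    R   : Ω → Ω → Set ℓ
    V   : ℕ → Ω → Set ℓ
open Model public

data Form : Set where
  var  : ℕ → Form
  ¬′_  : Form → Form
  _∧′_ : Form → Form → Form
  □_   : Form → Form
  ∃′   : ℕ → Form → Form
  U_   : Form → Form

_[_↦_] : ∀ {ℓ} (M : Model ℓ) → ℕ → (Ω M → Set ℓ) → Model ℓ
M [ p ↦ X ] = record
  { Ω = Ω M ; inh = inh M ; R = R M
  ; V = λ q → λ w → case q ≟ p of λ where
                       (yes _) → X w
                       (no _)  → V M q w }
  where
    case_of_ : ∀ {a b} {A : Set a} {B : Set b} → A → (A → B) → B
    case x of f = f x

_,_⊨_ : ∀ {ℓ} (M : Model ℓ) → Ω M → Form → Set (lsuc ℓ)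
_,_⊨_ {ℓ} M w (var p)  = Lift (lsuc ℓ) (V M p w)
M , w ⊨ (¬′ φ)         = ¬ (M , w ⊨ φ)
M , w ⊨ (φ ∧′ ψ)       = (M , w ⊨ φ) × (M , w ⊨ ψ)
M , w ⊨ (□ φ)          = ∀ w' → R M w w' → M , w' ⊨ φ
M , w ⊨ (∃′ p φ)       = Σ (Ω M → Set _) λ X → (M [ p ↦ X ]) , w ⊨ φ
M , w ⊨ (U φ)          = ∀ w' → M , w' ⊨ φ

record EventModel : Set₁ where
  field
    k   : ℕ
    E   : Fin (suc k) → Fin (suc k) → Set
    Pre : Fin (suc k) → Form
open EventModel public

Event : EventModel → Set
Event A = Fin (suc (k A))

-- Since Model requires a non-empty domain, the product
-- is formed given one of its points (it is only ever used at such a point).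
ProdΩ : ∀ {ℓ} (M : Model ℓ) (A : EventModel) → Set (lsuc ℓ)
ProdΩ M A = Σ (Ω M × Event A) (λ wb → M , proj₁ wb ⊨ Pre A (proj₂ wb))

_⊗_at_ : ∀ {ℓ} (M : Model ℓ) (A : EventModel) → ProdΩ M A → Model (lsuc ℓ)
_⊗_at_ {ℓ} M A x₀ = record
  { Ω   = ProdΩ M A
  ; inh = x₀
  ; R   = λ x y → Lift (lsuc ℓ) (R M (proj₁ (proj₁ x)) (proj₁ (proj₁ y)))
                   × Lift (lsuc ℓ) (E A (proj₂ (proj₁ x)) (proj₂ (proj₁ y)))
  ; V   = λ p x → Lift (lsuc ℓ) (V M p (proj₁ (proj₁ x))) }

⟨_∣_⟩_at_,_ : ∀ {ℓ} (A : EventModel) → Event A → Form → (M : Model ℓ) → Ω M → Set (lsuc (lsuc ℓ))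
⟨ A ∣ α ⟩ φ at M , w =
  Σ (M , w ⊨ Pre A α) λ pre →
    let x : ProdΩ M A
        x = ((w , α) , pre)
    in (M ⊗ A at x) , x ⊨ φ

record Bisim {a b} (M : Model a) (M' : Model b) (z : Level) : Set (a ⊔ b ⊔ lsuc z) where
  field
    Z     : Ω M → Ω M' → Set z
    atoms : ∀ {w w'} → Z w w' → ∀ p → V M p w ⇔ V M' p w'
    forth : ∀ {w w' v} → Z w w' → R M w v → Σ (Ω M') λ v' → R M' w' v' × Z v v'
    back  : ∀ {w w' v'} → Z w w' → R M' w' v' → Σ (Ω M) λ v → R M w v × Z v v'
open Bisim public

BisimInvariant : Form → Setω
BisimInvariant φ = ∀ {a b z} (M : Model a) (M' : Model b) (B : Bisim M M' z)
  (w : Ω M) (w' : Ω M') → Z B w w' → (M , w ⊨ φ) ⇔ (M' , w' ⊨ φ)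

BisimInvariant⟨_∣_⟩_ : (A : EventModel) → Event A → Form → Setω
BisimInvariant⟨ A ∣ α ⟩ φ = ∀ {a b z} (M : Model a) (M' : Model b) (B : Bisim M M' z)
  (w : Ω M) (w' : Ω M') → Z B w w' →
  (⟨ A ∣ α ⟩ φ at M , w) ⇔ (⟨ A ∣ α ⟩ φ at M' , w')

-- A bisimulation Z between M and M' lifts to the product updates: relate (w , β)
-- and (w' , β) whenever Z w w'.  The back-and-forth clauses go through because
-- bisimilar worlds agree on every precondition, so a successor found in one
-- model survives the update in the other.  ⟨α⟩φ then transfers along Z, using
-- invariance of Pre α at the root and invariance of φ in the products.
module Submission where

open import Defs
open import Level using (Lift; lift; lower)
open import Data.Product using (Σ; _×_; _,_)
open import Relation.Binary.PropositionalEquality using (_≡_; refl)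
open import Function.Bundles using (_⇔_; mk⇔; Equivalence)

open Equivalence

Lift-⇔ : ∀ {a b ℓ ℓ'} {P : Set a} {Q : Set b} → P ⇔ Q → Lift ℓ P ⇔ Lift ℓ' Q
Lift-⇔ P⇔Q = mk⇔ (λ p → lift (to P⇔Q (lower p))) (λ q → lift (from P⇔Q (lower q)))

module _ (A : EventModel) (preInv : ∀ β → BisimInvariant (Pre A β))
         {a b z} {M : Model a} {M' : Model b} (B : Bisim M M' z) where

  Z-⊗ : ProdΩ M A → ProdΩ M' A → Set z
  Z-⊗ ((w , β) , _) ((w' , β') , _) = Z B w w' × β ≡ β'

  ⊗-bisim : ∀ x₀ x₀' → Bisim (M ⊗ A at x₀) (M' ⊗ A at x₀') z
  Z     (⊗-bisim _ _) = Z-⊗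
  atoms (⊗-bisim _ _) (zw , refl) p = Lift-⇔ (atoms B zw p)
  forth (⊗-bisim _ _) {v = (v , γ) , pre} (zw , refl) (lift r , lift e) =
    let (v' , r' , zv) = forth B zw r
    in ((v' , γ) , to (preInv γ M M' B v v' zv) pre) , (lift r' , lift e) , (zv , refl)
  back  (⊗-bisim _ _) {v' = (v' , γ) , pre'} (zw , refl) (lift r' , lift e) =
    let (v , r , zv) = back B zw r'
    in ((v , γ) , from (preInv γ M M' B v v' zv) pre') , (lift r , lift e) , (zv , refl)

lemma4 : (A : EventModel) (α : Event A) (φ : Form) →
         BisimInvariant φ → (∀ β → BisimInvariant (Pre A β)) →
         BisimInvariant⟨ A ∣ α ⟩ φ
lemma4 A α φ φInv preInv M M' B w w' zw = mk⇔
  (λ (pre , sat) → let pre' = to pre⇔ pre in pre' , to (φ⇔ pre pre') sat)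
  (λ (pre' , sat) → let pre = from pre⇔ pre' in pre , from (φ⇔ pre pre') sat)
  where
    pre⇔ : (M , w ⊨ Pre A α) ⇔ (M' , w' ⊨ Pre A α)
    pre⇔ = preInv α M M' B w w' zw

    φ⇔ : ∀ pre pre' → let x = ((w , α) , pre) ; x' = ((w' , α) , pre') in
         ((M ⊗ A at x) , x ⊨ φ) ⇔ ((M' ⊗ A at x') , x' ⊨ φ)
    φ⇔ pre pre' = φInv _ _ (⊗-bisim A preInv B _ _) _ _ (zw , refl)
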